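{- Let $G$ be a bipartite graph with bipartition $(X,Y)$, and let $S$ be a binding set of $G$. If $S\cap X\neq\emptyset$ and $S\cap Y\neq\emptyset$, then $S\cap X$ and $S\cap Y$ are also binding sets of $G$.
   Context: Graphs are finite and simple. For $S\subseteq V(G)$, $N_G(S)$ is the union of the neighborhoods of the vertices of $S$. The binding number is $b(G)=\min\{|N_G(S)|/|S|:\emptyset\neq S\subseteq V(G),\ N_G(S)\neq V(G)\}$. A nonempty subset $S\subseteq V(G)$ is called a binding set if $b(G)=|N_G(S)|/|S|$. -}

module Defs where

open import Data.Nat using (ℕ; _*_; _≤_)
open import Data.Bool using (Bool; true; false; _∧_; _∨_; T)
open import Data.Fin using (Fin; zero; suc)
open import Data.Vec using (tabulate; lookup)
open import Data.Fin.Subset using (Subset; Nonempty; ∣_∣; _∈_; _∩_; _∪_; ⊤; ⊥)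
open import Data.Product using (Σ; _×_; ∃)
open import Relation.Binary.PropositionalEquality using (_≡_; _≢_)
open import Relation.Nullary using (¬_)

record Graph (n : ℕ) : Set where
  field
    adj   : Fin n → Fin n → Bool
    sym   : ∀ u v → adj u v ≡ adj v u
    irrefl : ∀ v → adj v v ≡ false
open Graph public

anyFin : ∀ {n} → (Fin n → Bool) → Bool
anyFin {ℕ.zero}  f = false
anyFin {ℕ.suc n} f = f zero ∨ anyFin (λ i → f (suc i))

N : ∀ {n} → Graph n → Subset n → Subset n
N G S = tabulate (λ v → anyFin (λ u → lookup S u ∧ adj G u v))

Admissible : ∀ {n} → Graph n → Subset n → Set
Admissible G S = Nonempty S × N G S ≢ ⊤

-- S is a binding set: S ≠ ∅ and |N(S)|/|S| = b(G), where b(G) is the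
-- minimum of |N(T)|/|T| over admissible T, attained at some admissible T₀.
-- Ratios are compared by cross-multiplication (all denominators positive).
BindingSet : ∀ {n} → Graph n → Subset n → Set
BindingSet G S =
  Nonempty S ×
  Σ _ (λ T₀ → Admissible G T₀ ×
               (∣ N G T₀ ∣ * ∣ S ∣ ≡ ∣ N G S ∣ * ∣ T₀ ∣) ×
               (∀ T → Admissible G T → ∣ N G T₀ ∣ * ∣ T ∣ ≤ ∣ N G T ∣ * ∣ T₀ ∣))

Bipartition : ∀ {n} → Graph n → Subset n → Subset n → Set
Bipartition G X Y =
  (X ∪ Y ≡ ⊤) × (X ∩ Y ≡ ⊥) ×
  (∀ u v → T (adj G u v) → (u ∈ X × v ∈ Y) Data.Sum.⊎ (u ∈ Y × v ∈ X))
  where import Data.Sum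

{-# OPTIONS --safe #-}
module Submission where

-- Write S = S_X ∪ S_Y with S_X = S ∩ X and S_Y = S ∩ Y. Every neighbour of
-- S_X lies in Y and every neighbour of S_Y in X, so both |S| and |N(S)| split
-- as sums over S_X and S_Y, and N(S_X) misses S_X (so S_X is admissible),
-- likewise for S_Y. Minimality of b = b(G) gives b|S_X| ≤ |N(S_X)| and
-- b|S_Y| ≤ |N(S_Y)|; their sum is the equality b|S| = |N(S)|, so both are
-- equalities.

open import Defs hiding (sym)
open import Data.Nat using (ℕ; zero; suc; _+_; _*_; _≤_)
open import Data.Nat.Properties
  using (+-suc; +-comm; ≤-antisym; +-cancelʳ-≤; +-monoʳ-≤; *-distribˡ-+; *-distribʳ-+)
open import Data.Bool using (Bool; T; _∧_)
open import Data.Bool.Properties using (T-≡; T-∧; T-∨)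
open import Data.Empty using (⊥-elim)
open import Data.Fin using (Fin; zero; suc)
open import Data.Fin.Subset
  using (Subset; Nonempty; _∈_; _∉_; _⊆_; _∩_; _∪_; ∣_∣; inside; outside)
  renaming (⊤ to ⊤ₛ; ⊥ to ⊥ₛ)
open import Data.Fin.Subset.Properties
  using (∈⊤; ∉⊥; ⊆-antisym; Empty-unique; x∈p∩q⁺; x∈p∩q⁻; p∩q⊆q;
         x∈p∪q⁺; x∈p∪q⁻; p⊆p∪q; q⊆p∪q; ∩-comm; ∪-comm; ∩-identityʳ; ∩-distribˡ-∪)
open import Data.Vec using ([]; _∷_; lookup; tabulate)
open import Data.Vec.Properties using (lookup∘tabulate; []=⇒lookup; lookup⇒[]=; ∷-injectiveʳ)
open import Data.Product using (_×_; _,_; ∃; proj₁)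
import Data.Product as Product
open import Data.Sum using (inj₁; inj₂; [_,_])
import Data.Sum as Sum
open import Function using (_∘_; id)
open import Function.Bundles using (module Equivalence)
open import Relation.Binary.PropositionalEquality
  using (_≡_; refl; sym; trans; cong; subst; module ≡-Reasoning)

open Equivalence using (to; from)

private
  variable
    n : ℕ

m≤n⇒o≤p⇒m+o≡n+p⇒m≡n : ∀ {m n o p} → m ≤ n → o ≤ p → m + o ≡ n + p → m ≡ n
m≤n⇒o≤p⇒m+o≡n+p⇒m≡n {m} {n} {o} {p} m≤n o≤p eq =
  ≤-antisym m≤n (+-cancelʳ-≤ p n m (subst (_≤ m + p) eq (+-monoʳ-≤ m o≤p)))

anyFin⁺ : (f : Fin n → Bool) {i : Fin n} → T (f i) → T (anyFin f)
anyFin⁺ f {zero}  t = from T-∨ (inj₁ t)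
anyFin⁺ f {suc i} t = from T-∨ (inj₂ (anyFin⁺ (f ∘ suc) t))

anyFin⁻ : (f : Fin n → Bool) → T (anyFin f) → ∃ λ i → T (f i)
anyFin⁻ {zero}  f ()
anyFin⁻ {suc n} f t with to T-∨ t
... | inj₁ t₀ = zero , t₀
... | inj₂ t′ = Product.map suc id (anyFin⁻ (f ∘ suc) t′)

∈⇒T-lookup : {p : Subset n} {x : Fin n} → x ∈ p → T (lookup p x)
∈⇒T-lookup x∈p = from T-≡ ([]=⇒lookup x∈p)

T-lookup⇒∈ : {p : Subset n} {x : Fin n} → T (lookup p x) → x ∈ p
T-lookup⇒∈ {p = p} {x} t = lookup⇒[]= x p (to T-≡ t)

∈tabulate⁺ : {f : Fin n → Bool} {x : Fin n} → T (f x) → x ∈ tabulate f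
∈tabulate⁺ {f = f} {x} t = T-lookup⇒∈ (subst T (sym (lookup∘tabulate f x)) t)

∈tabulate⁻ : {f : Fin n → Bool} {x : Fin n} → x ∈ tabulate f → T (f x)
∈tabulate⁻ {f = f} {x} x∈ = subst T (lookup∘tabulate f x) (∈⇒T-lookup x∈)

∈-disjoint : {p q : Subset n} {x : Fin n} → p ∩ q ≡ ⊥ₛ → x ∈ p → x ∉ q
∈-disjoint {x = x} p∩q≡⊥ x∈p x∈q = ∉⊥ (subst (x ∈_) p∩q≡⊥ (x∈p∩q⁺ (x∈p , x∈q)))

⊆-disjoint : {p q r s : Subset n} → p ⊆ r → q ⊆ s → r ∩ s ≡ ⊥ₛ → p ∩ q ≡ ⊥ₛ
⊆-disjoint {p = p} {q} p⊆r q⊆s r∩s≡⊥ = Empty-unique λ where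
  (x , x∈p∩q) → let (x∈p , x∈q) = x∈p∩q⁻ p q x∈p∩q in
                ∈-disjoint r∩s≡⊥ (p⊆r x∈p) (q⊆s x∈q)

∣p∪q∣≡∣p∣+∣q∣ : {p q : Subset n} → p ∩ q ≡ ⊥ₛ → ∣ p ∪ q ∣ ≡ ∣ p ∣ + ∣ q ∣
∣p∪q∣≡∣p∣+∣q∣ {p = []}          {[]}          _  = refl
∣p∪q∣≡∣p∣+∣q∣ {p = inside  ∷ p} {inside  ∷ q} ()
∣p∪q∣≡∣p∣+∣q∣ {p = inside  ∷ p} {outside ∷ q} eq = cong suc (∣p∪q∣≡∣p∣+∣q∣ (∷-injectiveʳ eq))
∣p∪q∣≡∣p∣+∣q∣ {p = outside ∷ p} {inside  ∷ q} eq =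
  trans (cong suc (∣p∪q∣≡∣p∣+∣q∣ (∷-injectiveʳ eq))) (sym (+-suc ∣ p ∣ ∣ q ∣))
∣p∪q∣≡∣p∣+∣q∣ {p = outside ∷ p} {outside ∷ q} eq = ∣p∪q∣≡∣p∣+∣q∣ (∷-injectiveʳ eq)

p≡p∩q∪p∩r : (p : Subset n) {q r : Subset n} → q ∪ r ≡ ⊤ₛ → p ≡ (p ∩ q) ∪ (p ∩ r)
p≡p∩q∪p∩r p {q} {r} q∪r≡⊤ = begin
  p             ≡⟨ sym (∩-identityʳ p) ⟩
  p ∩ ⊤ₛ        ≡⟨ cong (p ∩_) (sym q∪r≡⊤) ⟩
  p ∩ (q ∪ r)   ≡⟨ ∩-distribˡ-∪ p q r ⟩
  p ∩ q ∪ p ∩ r ∎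
  where open ≡-Reasoning

∣p∣≡∣p∩q∣+∣p∩r∣ : (p : Subset n) {q r : Subset n} → q ∪ r ≡ ⊤ₛ → q ∩ r ≡ ⊥ₛ →
                  ∣ p ∣ ≡ ∣ p ∩ q ∣ + ∣ p ∩ r ∣
∣p∣≡∣p∩q∣+∣p∩r∣ p {q} {r} q∪r≡⊤ q∩r≡⊥ =
  trans (cong ∣_∣ (p≡p∩q∪p∩r p q∪r≡⊤))
        (∣p∪q∣≡∣p∣+∣q∣ (⊆-disjoint (p∩q⊆q p q) (p∩q⊆q p r) q∩r≡⊥))

module _ (G : Graph n) where

  ∈N⁺ : {S : Subset n} {u v : Fin n} → u ∈ S → T (adj G u v) → v ∈ N G S
  ∈N⁺ {S} {u} {v} u∈S uv =
    ∈tabulate⁺ (anyFin⁺ (λ w → lookup S w ∧ adj G w v) (from T-∧ (∈⇒T-lookup u∈S , uv)))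

  ∈N⁻ : {S : Subset n} {v : Fin n} → v ∈ N G S → ∃ λ u → u ∈ S × T (adj G u v)
  ∈N⁻ v∈NS with anyFin⁻ _ (∈tabulate⁻ v∈NS)
  ... | u , t = let (Su , uv) = to T-∧ t in u , T-lookup⇒∈ Su , uv

  N-mono : {p q : Subset n} → p ⊆ q → N G p ⊆ N G q
  N-mono p⊆q v∈Np with ∈N⁻ v∈Np
  ... | u , u∈p , uv = ∈N⁺ (p⊆q u∈p) uv

  N-∪ : (p q : Subset n) → N G (p ∪ q) ≡ N G p ∪ N G q
  N-∪ p q = ⊆-antisym N[p∪q]⊆ ⊆N[p∪q]
    where
    N[p∪q]⊆ : N G (p ∪ q) ⊆ N G p ∪ N G q
    N[p∪q]⊆ v∈N with ∈N⁻ v∈N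
    ... | u , u∈p∪q , uv =
      x∈p∪q⁺ (Sum.map (λ u∈p → ∈N⁺ u∈p uv) (λ u∈q → ∈N⁺ u∈q uv) (x∈p∪q⁻ p q u∈p∪q))

    ⊆N[p∪q] : N G p ∪ N G q ⊆ N G (p ∪ q)
    ⊆N[p∪q] v∈ =
      [ N-mono (p⊆p∪q {p = p} q) , N-mono (q⊆p∪q p q) ] (x∈p∪q⁻ (N G p) (N G q) v∈)

  Bipartition-swap : {X Y : Subset n} → Bipartition G X Y → Bipartition G Y X
  Bipartition-swap {X} {Y} (X∪Y≡⊤ , X∩Y≡⊥ , edge) =
    trans (∪-comm Y X) X∪Y≡⊤ , trans (∩-comm Y X) X∩Y≡⊥ , λ u v uv → Sum.swap (edge u v uv)

  N⊆opposite : {X Y : Subset n} → Bipartition G X Y → N G X ⊆ Y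
  N⊆opposite (_ , X∩Y≡⊥ , edge) v∈NX with ∈N⁻ v∈NX
  ... | u , u∈X , uv with edge u _ uv
  ...   | inj₁ (_ , v∈Y) = v∈Y
  ...   | inj₂ (u∈Y , _) = ⊥-elim (∈-disjoint X∩Y≡⊥ u∈X u∈Y)

  admissible-⊆ : {X Y p : Subset n} → Bipartition G X Y → Nonempty p → p ⊆ X → Admissible G p
  admissible-⊆ B@(_ , X∩Y≡⊥ , _) ne@(x , x∈p) p⊆X = ne , λ Np≡⊤ →
    ∈-disjoint X∩Y≡⊥ (p⊆X x∈p) (N⊆opposite B (N-mono p⊆X (subst (x ∈_) (sym Np≡⊤) ∈⊤)))

  ∣NS∣≡∣N[S∩X]∣+∣N[S∩Y]∣ : {X Y : Subset n} → Bipartition G X Y →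
                    (S : Subset n) → ∣ N G S ∣ ≡ ∣ N G (S ∩ X) ∣ + ∣ N G (S ∩ Y) ∣
  ∣NS∣≡∣N[S∩X]∣+∣N[S∩Y]∣ {X} {Y} B@(X∪Y≡⊤ , X∩Y≡⊥ , _) S = begin
    ∣ N G S ∣                             ≡⟨ cong (∣_∣ ∘ N G) (p≡p∩q∪p∩r S X∪Y≡⊤) ⟩
    ∣ N G (S ∩ X ∪ S ∩ Y) ∣               ≡⟨ cong ∣_∣ (N-∪ (S ∩ X) (S ∩ Y)) ⟩
    ∣ N G (S ∩ X) ∪ N G (S ∩ Y) ∣         ≡⟨ ∣p∪q∣≡∣p∣+∣q∣ N[S∩X]∩N[S∩Y]≡⊥ ⟩
    ∣ N G (S ∩ X) ∣ + ∣ N G (S ∩ Y) ∣     ∎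
    where
    open ≡-Reasoning
    N[S∩X]∩N[S∩Y]≡⊥ : N G (S ∩ X) ∩ N G (S ∩ Y) ≡ ⊥ₛ
    N[S∩X]∩N[S∩Y]≡⊥ =
      ⊆-disjoint (N⊆opposite B ∘ N-mono (p∩q⊆q S X))
                 (N⊆opposite (Bipartition-swap B) ∘ N-mono (p∩q⊆q S Y))
                 (trans (∩-comm Y X) X∩Y≡⊥)

  BindingSet-summand : {S A C : Subset n} → BindingSet G S →
    Admissible G A → Admissible G C →
    ∣ S ∣ ≡ ∣ A ∣ + ∣ C ∣ → ∣ N G S ∣ ≡ ∣ N G A ∣ + ∣ N G C ∣ →
    BindingSet G A
  BindingSet-summand {S} {A} {C} (_ , T₀ , adm₀ , ratio-S , minimal)
                     admA admC ∣S∣-split ∣NS∣-split =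
    proj₁ admA , T₀ , adm₀ ,
    m≤n⇒o≤p⇒m+o≡n+p⇒m≡n (minimal A admA) (minimal C admC) sum-equal , minimal
    where
    open ≡-Reasoning
    b t : ℕ
    b = ∣ N G T₀ ∣
    t = ∣ T₀ ∣
    sum-equal : b * ∣ A ∣ + b * ∣ C ∣ ≡ ∣ N G A ∣ * t + ∣ N G C ∣ * t
    sum-equal = begin
      b * ∣ A ∣ + b * ∣ C ∣           ≡⟨ sym (*-distribˡ-+ b ∣ A ∣ ∣ C ∣) ⟩
      b * (∣ A ∣ + ∣ C ∣)             ≡⟨ cong (b *_) (sym ∣S∣-split) ⟩
      b * ∣ S ∣                       ≡⟨ ratio-S ⟩
      ∣ N G S ∣ * t                   ≡⟨ cong (_* t) ∣NS∣-split ⟩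
      (∣ N G A ∣ + ∣ N G C ∣) * t     ≡⟨ *-distribʳ-+ t ∣ N G A ∣ ∣ N G C ∣ ⟩
      ∣ N G A ∣ * t + ∣ N G C ∣ * t   ∎

lemma3p1 : ∀ {n} (G : Graph n) (X Y S : Subset n) →
    Bipartition G X Y → BindingSet G S →
    Nonempty (S ∩ X) → Nonempty (S ∩ Y) →
    BindingSet G (S ∩ X) × BindingSet G (S ∩ Y)
lemma3p1 G X Y S B@(X∪Y≡⊤ , X∩Y≡⊥ , _) bS neX neY =
  BindingSet-summand G bS admX admY ∣S∣-split ∣NS∣-split ,
  BindingSet-summand G bS admY admX
    (trans ∣S∣-split (+-comm ∣ S ∩ X ∣ ∣ S ∩ Y ∣))
    (trans ∣NS∣-split (+-comm ∣ N G (S ∩ X) ∣ ∣ N G (S ∩ Y) ∣))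
  where
  admX : Admissible G (S ∩ X)
  admX = admissible-⊆ G B neX (p∩q⊆q S X)
  admY : Admissible G (S ∩ Y)
  admY = admissible-⊆ G (Bipartition-swap G B) neY (p∩q⊆q S Y)
  ∣S∣-split : ∣ S ∣ ≡ ∣ S ∩ X ∣ + ∣ S ∩ Y ∣
  ∣S∣-split = ∣p∣≡∣p∩q∣+∣p∩r∣ S X∪Y≡⊤ X∩Y≡⊥
  ∣NS∣-split : ∣ N G S ∣ ≡ ∣ N G (S ∩ X) ∣ + ∣ N G (S ∩ Y) ∣
  ∣NS∣-split = ∣NS∣≡∣N[S∩X]∣+∣N[S∩Y]∣ G B S
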